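{- Let $n\ge 1$ and $\sigma\in S_n$, with disjoint cycle decomposition $\sigma=\rho_1\cdots\rho_l$ (fixed points counted as $1$-cycles). Let $\mu(\sigma)$ be the minimal number $k$ of transpositions $\tau_1,\dots,\tau_k\in S_n$ such that $\sigma=\tau_1\cdots\tau_k$ and the group generated by $\tau_1,\dots,\tau_k$ acts transitively on $\{1,\dots,n\}$. Suppose $\sigma=\tau_1\tau_2\cdots\tau_{\mu(\sigma)}$ is such a factorization (transpositions, product equal to $\sigma$, generating a transitive group), write $\tau_1=(j_2\ j_1)$ with $j_1\neq j_2$, and put $\sigma'=\tau_1\sigma=\tau_2\cdots\tau_{\mu(\sigma)}$. Then: (1) If $j_1,j_2$ lie in the same cycle $\rho_1$ of $\sigma$, then $\tau_1\rho_1$ is a product of two disjoint cycles, one containing $j_1$ and the other containing $j_2$; and $\{1,\dots,n\}$ has exactly two orbits under the group generated by $\tau_2,\dots,\tau_{\mu(\sigma)}$, one containing $j_1$ and the other containing $j_2$. (2) If $j_1,j_2$ lie in two different cycles $\rho_1\ni j_1$, $\rho_2\ni j_2$ of $\sigma$, then $\tau_1\rho_1\rho_2$ is a single cycle containing both $j_1$ and $j_2$, and the group generated by $\tau_2,\dots,\tau_{\mu(\sigma)}$ acts transitively on $\{1,\dots,n\}$.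
   Context: Products of permutations are composed right to left ($\sigma\tau$ means apply $\tau$ first), and a cycle $(a_1\ a_2\ \cdots\ a_r)$ sends $a_1\mapsto a_2\mapsto\cdots\mapsto a_r\mapsto a_1$. It is known (and may be used) that $\mu(\sigma)=n+l-2$, where $l$ is the number of cycles of $\sigma$ including fixed points. -}

module Defs where

open import Data.Nat using (ℕ; zero; suc; _≤_)
open import Data.Fin using (Fin)
open import Data.Fin.Permutation using (Permutation′; _⟨$⟩ʳ_; transpose)
open import Data.List using (List; []; _∷_; length)
open import Data.List.Membership.Propositional using (_∈_)
open import Data.Product using (Σ; ∃; _×_; _,_)
open import Relation.Nullary using (¬_)
open import Relation.Binary.PropositionalEquality using (_≡_; _≢_)
open import Function using (_∘_)

record Transposition (n : ℕ) : Set where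
  constructor trans
  field
    a b  : Fin n
    a≢b : a ≢ b

⟦_⟧ : {n : ℕ} → Transposition n → Fin n → Fin n
⟦ trans a b _ ⟧ = transpose a b ⟨$⟩ʳ_

-- Product τ₁ τ₂ ⋯ τ_k, composed right to left (τ_k applied first).
prod : {n : ℕ} → List (Transposition n) → Fin n → Fin n
prod []       x = x
prod (t ∷ ts) x = ⟦ t ⟧ (prod ts x)

-- Since transpositions are involutions, the
-- elements of ⟨ts⟩ are exactly the finite products of members of ts.
data Orbit {n : ℕ} (ts : List (Transposition n)) : Fin n → Fin n → Set where
  here : ∀ {x} → Orbit ts x x
  step : ∀ {t x y} → t ∈ ts → Orbit ts (⟦ t ⟧ x) y → Orbit ts x y

TransitiveOn : {n : ℕ} → List (Transposition n) → Set
TransitiveOn ts = ∀ x y → Orbit ts x y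

TransFact : {n : ℕ} → Permutation′ n → List (Transposition n) → Set
TransFact σ ts = (∀ x → σ ⟨$⟩ʳ x ≡ prod ts x) × TransitiveOn ts

MinTransFact : {n : ℕ} → Permutation′ n → List (Transposition n) → Set
MinTransFact σ ts =
  TransFact σ ts × (∀ ts′ → TransFact σ ts′ → length ts ≤ length ts′)

iter : {n : ℕ} → (Fin n → Fin n) → ℕ → Fin n → Fin n
iter f zero    x = x
iter f (suc k) x = f (iter f k x)

SameCycle : {n : ℕ} → (Fin n → Fin n) → Fin n → Fin n → Set
SameCycle f x y = ∃ λ k → iter f k x ≡ y

-- ρ is the cycle of σ (in its disjoint cycle decomposition) containing j:
-- ρ agrees with σ on the σ-cycle of j and is the identity elsewhere.
IsCycleOf : {n : ℕ} → Permutation′ n → Fin n → (Fin n → Fin n) → Set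
IsCycleOf σ j ρ = ∀ x →
  (SameCycle (σ ⟨$⟩ʳ_) j x → ρ x ≡ σ ⟨$⟩ʳ x) ×
  (¬ SameCycle (σ ⟨$⟩ʳ_) j x → ρ x ≡ x)

module Submission where

-- Write l(f) for the number of cycles of an injective map f on Fin n, and c(ts)
-- for the number of orbits of the group generated by a list ts of
-- transpositions.  Everything rests on how left multiplication by a
-- transposition (a b) changes the cycles of f: if a and b lie in different
-- cycles, (a b)f has the cycles of f with these two merged; if they lie in the
-- same cycle, that cycle splits into one through a and one through b.  Both
-- facts say that one cycle relation is the join at a, b of the other, and a
-- counting lemma turns such a join into a difference of exactly one class.
-- Consequences: (i) n + l(∏ts) ≤ |ts| + 2c(ts) for every list ts, and (ii)
-- every f has a transitive factorization with n + l(f) − 2 factors.  In case (1)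
-- τ₁ splits a cycle of σ, so if ⟨τ₂,…⟩ were transitive, (i) for σ' would beat
-- the minimal length bounded by (ii); in case (2) τ₁ merges two cycles, so j₁ and
-- j₂ already share an orbit of ⟨τ₂,…⟩.  The claims about τ₁ρ₁ and τ₁ρ₁ρ₂ follow
-- from the same merge/split lemmas, since ρ₁ (resp. ρ₁ρ₂) agrees with σ on a
-- σ-invariant set and is the identity elsewhere.

open import Defs
open import Data.Nat using (ℕ; zero; suc; _+_; _*_; _∸_; _≤_; _<_; s≤s; z≤n)
import Data.Nat.Properties as ℕ
open import Data.Nat.DivMod using (_%_; _/_; m%n<n; m≡m%n+[m/n]*n)
open import Data.Fin using (Fin; zero; suc; toℕ; fromℕ<)
open import Data.Fin.Properties
  using (_≟_; toℕ-injective; suc-injective; all?; any?; ¬∀⟶∃¬; pigeonhole; toℕ-fromℕ<)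
open import Data.Fin.Permutation using (Permutation′; _⟨$⟩ʳ_; _⟨$⟩ˡ_; transpose; inverseˡ)
open import Data.List using (List; []; _∷_; length)
open import Data.List.Membership.Propositional using (_∈_)
open import Data.List.Relation.Unary.Any using (here; there)
open import Data.Product using (Σ; ∃; _×_; _,_; proj₁; proj₂)
open import Data.Sum using (_⊎_; inj₁; inj₂)
open import Data.Empty using (⊥-elim)
open import Function.Definitions using (Injective)
open import Relation.Nullary using (¬_; Dec; yes; no)
open import Relation.Nullary.Decidable using (_⊎-dec_; _×-dec_; ¬?; _→-dec_; map′)
open import Relation.Binary.Definitions using (tri<; tri≈; tri>)
open import Relation.Binary.Structures using (IsEquivalence)
open import Relation.Binary.PropositionalEquality
  using (_≡_; _≢_; refl; sym; cong; subst; module ≡-Reasoning)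
  renaming (trans to ≡-trans)

private
  variable
    n : ℕ

-- Injectivity of an endomap of Fin n.  On a finite set this is what makes
-- "lying in the same cycle" an equivalence relation.
Inj : (Fin n → Fin n) → Set
Inj = Injective _≡_ _≡_

∘-inj : {f g : Fin n → Fin n} → Inj f → Inj g → Inj (λ x → f (g x))
∘-inj f-inj g-inj e = g-inj (f-inj e)

τ : Fin n → Fin n → Fin n → Fin n
τ a b x = transpose a b ⟨$⟩ʳ x

τ-left : (a b : Fin n) → τ a b a ≡ b
τ-left a b with a ≟ a
... | yes _ = refl
... | no a≢a = ⊥-elim (a≢a refl)

τ-right : (a b : Fin n) → τ a b b ≡ a
τ-right a b with b ≟ a
... | yes b≡a = b≡a
... | no _ with b ≟ b
...   | yes _ = refl
...   | no b≢b = ⊥-elim (b≢b refl)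

τ-other : {a b x : Fin n} → x ≢ a → x ≢ b → τ a b x ≡ x
τ-other {a = a} {b} {x} x≢a x≢b with x ≟ a
... | yes x≡a = ⊥-elim (x≢a x≡a)
... | no _ with x ≟ b
...   | yes x≡b = ⊥-elim (x≢b x≡b)
...   | no _ = refl

τ-cases : (a b x : Fin n) → τ a b x ≡ x ⊎ τ a b x ≡ a ⊎ τ a b x ≡ b
τ-cases a b x = by-cases (x ≟ a) (x ≟ b)
  where
  by-cases : Dec (x ≡ a) → Dec (x ≡ b) → τ a b x ≡ x ⊎ τ a b x ≡ a ⊎ τ a b x ≡ b
  by-cases (yes refl) _          = inj₂ (inj₂ (τ-left a b))
  by-cases (no _)     (yes refl) = inj₂ (inj₁ (τ-right a b))
  by-cases (no x≢a)   (no x≢b)   = inj₁ (τ-other x≢a x≢b)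

τ-involutive : (a b x : Fin n) → τ a b (τ a b x) ≡ x
τ-involutive a b x = by-cases (x ≟ a) (x ≟ b)
  where
  by-cases : Dec (x ≡ a) → Dec (x ≡ b) → τ a b (τ a b x) ≡ x
  by-cases (yes refl) _          = ≡-trans (cong (τ a b) (τ-left a b)) (τ-right a b)
  by-cases (no _)     (yes refl) = ≡-trans (cong (τ a b) (τ-right a b)) (τ-left a b)
  by-cases (no x≢a)   (no x≢b)   = ≡-trans (cong (τ a b) (τ-other x≢a x≢b)) (τ-other x≢a x≢b)

τ-inj : (a b : Fin n) → Inj (τ a b)
τ-inj a b {x} {y} e = begin
  x                 ≡⟨ sym (τ-involutive a b x) ⟩
  τ a b (τ a b x)   ≡⟨ cong (τ a b) e ⟩
  τ a b (τ a b y)   ≡⟨ τ-involutive a b y ⟩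
  y                 ∎
  where open ≡-Reasoning

iter-+ : (f : Fin n → Fin n) → ∀ j k x → iter f (j + k) x ≡ iter f j (iter f k x)
iter-+ f zero    k x = refl
iter-+ f (suc j) k x = cong f (iter-+ f j k x)

iter-cong : {f g : Fin n → Fin n} → (∀ x → f x ≡ g x) → ∀ k x → iter f k x ≡ iter g k x
iter-cong f≗g zero    x = refl
iter-cong {f = f} f≗g (suc k) x = ≡-trans (cong f (iter-cong f≗g k x)) (f≗g _)

iter-inj : {f : Fin n → Fin n} → Inj f → ∀ k → Inj (iter f k)
iter-inj f-inj zero    e = e
iter-inj f-inj (suc k) e = iter-inj f-inj k (f-inj e)

-- Every point of an injective map on a finite set is periodic: by pigeonhole two
-- of x, f x, …, fⁿ x coincide, and injectivity cancels the common prefix.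
periodic : {f : Fin n → Fin n} → Inj f → ∀ x → ∃ λ p → iter f (suc p) x ≡ x
periodic {n = n} {f} f-inj x
  with pigeonhole (ℕ.n<1+n n) (λ (i : Fin (suc n)) → iter f (toℕ i) x)
... | i , j , i<j , fⁱx≡fʲx = p , sym (iter-inj f-inj (toℕ i) fⁱx≡fⁱ⁺ᵖ⁺¹x)
  where
  p : ℕ
  p = toℕ j ∸ suc (toℕ i)
  j≡i+p+1 : toℕ j ≡ toℕ i + suc p
  j≡i+p+1 = sym (≡-trans (ℕ.+-comm (toℕ i) (suc p))
                 (≡-trans (sym (ℕ.+-suc p (toℕ i))) (ℕ.m∸n+n≡m i<j)))
  fⁱx≡fⁱ⁺ᵖ⁺¹x : iter f (toℕ i) x ≡ iter f (toℕ i) (iter f (suc p) x)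
  fⁱx≡fⁱ⁺ᵖ⁺¹x = ≡-trans fⁱx≡fʲx
    (≡-trans (cong (λ k → iter f k x) j≡i+p+1) (iter-+ f (toℕ i) (suc p) x))

iter-multiple : {f : Fin n → Fin n} → ∀ s x → iter f s x ≡ x → ∀ m → iter f (m * s) x ≡ x
iter-multiple s x fˢx≡x zero = refl
iter-multiple {f = f} s x fˢx≡x (suc m) =
  ≡-trans (iter-+ f s (m * s) x) (≡-trans (cong (iter f s) (iter-multiple s x fˢx≡x m)) fˢx≡x)

module _ {f : Fin n → Fin n} where

  sameCycle-refl : ∀ {x} → SameCycle f x x
  sameCycle-refl = 0 , refl

  sameCycle-step : ∀ {x} → SameCycle f x (f x)
  sameCycle-step = 1 , refl

  sameCycle-trans : ∀ {x y z} → SameCycle f x y → SameCycle f y z → SameCycle f x z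
  sameCycle-trans {x = x} (k , fᵏx≡y) (j , fʲy≡z) =
    j + k , ≡-trans (iter-+ f j k x) (≡-trans (cong (iter f j) fᵏx≡y) fʲy≡z)

  -- Going backwards from y = fᵏ x: iterate forward to a multiple of the period.
  sameCycle-sym : Inj f → ∀ {x y} → SameCycle f x y → SameCycle f y x
  sameCycle-sym f-inj {x} (k , refl) with periodic f-inj x
  ... | p , fᵖ⁺¹x≡x = k * suc p ∸ k , (begin
    iter f (k * suc p ∸ k) (iter f k x)   ≡⟨ sym (iter-+ f (k * suc p ∸ k) k x) ⟩
    iter f (k * suc p ∸ k + k) x          ≡⟨ cong (λ j → iter f j x) (ℕ.m∸n+n≡m (ℕ.m≤m*n k (suc p))) ⟩
    iter f (k * suc p) x                  ≡⟨ iter-multiple (suc p) x fᵖ⁺¹x≡x k ⟩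
    x                                     ∎)
    where open ≡-Reasoning

  sameCycle-isEquivalence : Inj f → IsEquivalence (SameCycle f)
  sameCycle-isEquivalence f-inj = record
    { refl = sameCycle-refl ; sym = sameCycle-sym f-inj ; trans = sameCycle-trans }

  -- Decidable, since only the exponents below the period of x need checking.
  sameCycle-dec : Inj f → ∀ x y → Dec (SameCycle f x y)
  sameCycle-dec f-inj x y with periodic f-inj x
  ... | p , fᵖ⁺¹x≡x with any? (λ (r : Fin (suc p)) → iter f (toℕ r) x ≟ y)
  ...   | yes (r , fʳx≡y) = yes (toℕ r , fʳx≡y)
  ...   | no none = no λ (k , fᵏx≡y) → none (fromℕ< (m%n<n k (suc p)) , reduce k fᵏx≡y)
    where
    reduce : ∀ k → iter f k x ≡ y → iter f (toℕ (fromℕ< (m%n<n k (suc p)))) x ≡ y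
    reduce k fᵏx≡y = begin
      iter f (toℕ (fromℕ< (m%n<n k (suc p)))) x
        ≡⟨ cong (λ j → iter f j x) (toℕ-fromℕ< (m%n<n k (suc p))) ⟩
      iter f (k % suc p) x
        ≡⟨ cong (iter f (k % suc p)) (sym (iter-multiple (suc p) x fᵖ⁺¹x≡x (k / suc p))) ⟩
      iter f (k % suc p) (iter f (k / suc p * suc p) x)
        ≡⟨ sym (iter-+ f (k % suc p) (k / suc p * suc p) x) ⟩
      iter f (k % suc p + k / suc p * suc p) x
        ≡⟨ cong (λ j → iter f j x) (sym (m≡m%n+[m/n]*n k (suc p))) ⟩
      iter f k x
        ≡⟨ fᵏx≡y ⟩
      y ∎
      where open ≡-Reasoning

sameCycle-cong : {f g : Fin n → Fin n} → (∀ z → f z ≡ g z) → ∀ {x y} → SameCycle f x y → SameCycle g x y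
sameCycle-cong f≗g (k , fᵏx≡y) = k , ≡-trans (sym (iter-cong f≗g k _)) fᵏx≡y

Join : (R : Fin n → Fin n → Set) → Fin n → Fin n → Fin n → Fin n → Set
Join R a b x y = R x y ⊎ (R x a × R b y) ⊎ (R x b × R a y)

join-swap : ∀ {R : Fin n → Fin n → Set} {a b x y} → Join R a b x y → Join R b a x y
join-swap (inj₁ r)        = inj₁ r
join-swap (inj₂ (inj₁ p)) = inj₂ (inj₂ p)
join-swap (inj₂ (inj₂ p)) = inj₂ (inj₁ p)

join-dec : {R : Fin n → Fin n → Set} → (∀ x y → Dec (R x y)) → ∀ a b x y → Dec (Join R a b x y)
join-dec R? a b x y = R? x y ⊎-dec ((R? x a ×-dec R? b y) ⊎-dec (R? x b ×-dec R? a y))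

module _ {R : Fin n → Fin n → Set} (E : IsEquivalence R) where
  open IsEquivalence E renaming (refl to ≈-refl; sym to ≈-sym; trans to _⨾_)

  join-isEquivalence : ∀ a b → IsEquivalence (Join R a b)
  join-isEquivalence a b = record { refl = inj₁ ≈-refl ; sym = symmetric ; trans = transitive }
    where
    symmetric : ∀ {x y} → Join R a b x y → Join R a b y x
    symmetric (inj₁ xy)               = inj₁ (≈-sym xy)
    symmetric (inj₂ (inj₁ (xa , by))) = inj₂ (inj₂ (≈-sym by , ≈-sym xa))
    symmetric (inj₂ (inj₂ (xb , ay))) = inj₂ (inj₁ (≈-sym ay , ≈-sym xb))
    transitive : ∀ {x y z} → Join R a b x y → Join R a b y z → Join R a b x z
    transitive (inj₁ xy)               (inj₁ yz)               = inj₁ (xy ⨾ yz)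
    transitive (inj₁ xy)               (inj₂ (inj₁ (ya , bz))) = inj₂ (inj₁ (xy ⨾ ya , bz))
    transitive (inj₁ xy)               (inj₂ (inj₂ (yb , az))) = inj₂ (inj₂ (xy ⨾ yb , az))
    transitive (inj₂ (inj₁ (xa , by))) (inj₁ yz)               = inj₂ (inj₁ (xa , by ⨾ yz))
    transitive (inj₂ (inj₁ (xa , _)))  (inj₂ (inj₁ (_ , bz)))  = inj₂ (inj₁ (xa , bz))
    transitive (inj₂ (inj₁ (xa , _)))  (inj₂ (inj₂ (_ , az)))  = inj₁ (xa ⨾ az)
    transitive (inj₂ (inj₂ (xb , ay))) (inj₁ yz)               = inj₂ (inj₂ (xb , ay ⨾ yz))
    transitive (inj₂ (inj₂ (xb , _)))  (inj₂ (inj₁ (_ , bz)))  = inj₁ (xb ⨾ bz)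
    transitive (inj₂ (inj₂ (xb , _)))  (inj₂ (inj₂ (_ , az)))  = inj₂ (inj₂ (xb , az))

  join-collapse : ∀ {a b x y} → R a b → Join R a b x y → R x y
  join-collapse ab (inj₁ xy)               = xy
  join-collapse ab (inj₂ (inj₁ (xa , by))) = xa ⨾ (ab ⨾ by)
  join-collapse ab (inj₂ (inj₂ (xb , ay))) = xb ⨾ (≈-sym ab ⨾ ay)

-- The number of elements of Fin n satisfying a decidable predicate.  It is
-- opaque: the proof only uses the cardinality laws proved alongside it.
opaque
  count : (P : Fin n → Set) → (∀ x → Dec (P x)) → ℕ
  count {zero}  P P? = 0
  count {suc n} P P? with P? zero
  ... | yes _ = suc (count (λ x → P (suc x)) (λ x → P? (suc x)))
  ... | no _  = count (λ x → P (suc x)) (λ x → P? (suc x))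

  count-mono : {P Q : Fin n → Set} (P? : ∀ x → Dec (P x)) (Q? : ∀ x → Dec (Q x))
    → (∀ x → P x → Q x) → count P P? ≤ count Q Q?
  count-mono {zero}  P? Q? P⊆Q = z≤n
  count-mono {suc n} P? Q? P⊆Q with P? zero | Q? zero
  ... | yes _ | yes _ = s≤s (count-mono (λ x → P? (suc x)) (λ x → Q? (suc x)) (λ x → P⊆Q (suc x)))
  ... | yes p | no ¬q = ⊥-elim (¬q (P⊆Q zero p))
  ... | no _  | yes _ = ℕ.m≤n⇒m≤1+n (count-mono (λ x → P? (suc x)) (λ x → Q? (suc x)) (λ x → P⊆Q (suc x)))
  ... | no _  | no _  = count-mono (λ x → P? (suc x)) (λ x → Q? (suc x)) (λ x → P⊆Q (suc x))

  count-cong : {P Q : Fin n → Set} (P? : ∀ x → Dec (P x)) (Q? : ∀ x → Dec (Q x))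
    → (∀ x → P x → Q x) → (∀ x → Q x → P x) → count P P? ≡ count Q Q?
  count-cong P? Q? P⊆Q Q⊆P = ℕ.≤-antisym (count-mono P? Q? P⊆Q) (count-mono Q? P? Q⊆P)

  count-strict : {P Q : Fin n → Set} (P? : ∀ x → Dec (P x)) (Q? : ∀ x → Dec (Q x))
    → (∀ x → P x → Q x) → ∀ x₀ → Q x₀ → ¬ P x₀ → suc (count P P?) ≤ count Q Q?
  count-strict {suc n} P? Q? P⊆Q zero q ¬p with P? zero | Q? zero
  ... | yes p | _     = ⊥-elim (¬p p)
  ... | no _  | no ¬q = ⊥-elim (¬q q)
  ... | no _  | yes _ = s≤s (count-mono (λ x → P? (suc x)) (λ x → Q? (suc x)) (λ x → P⊆Q (suc x)))
  count-strict {suc n} P? Q? P⊆Q (suc x₀) q ¬p with P? zero | Q? zero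
  ... | yes _ | yes _ = s≤s (count-strict (λ x → P? (suc x)) (λ x → Q? (suc x)) (λ x → P⊆Q (suc x)) x₀ q ¬p)
  ... | yes p | no ¬q = ⊥-elim (¬q (P⊆Q zero p))
  ... | no _  | yes _ = ℕ.m≤n⇒m≤1+n (count-strict (λ x → P? (suc x)) (λ x → Q? (suc x)) (λ x → P⊆Q (suc x)) x₀ q ¬p)
  ... | no _  | no _  = count-strict (λ x → P? (suc x)) (λ x → Q? (suc x)) (λ x → P⊆Q (suc x)) x₀ q ¬p

  count-one-more : {P Q : Fin n → Set} (P? : ∀ x → Dec (P x)) (Q? : ∀ x → Dec (Q x))
    → (∀ x → P x → Q x) → ∀ x₀ → Q x₀ → ¬ P x₀ → (∀ x → x ≢ x₀ → Q x → P x)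
    → count Q Q? ≡ suc (count P P?)
  count-one-more {suc n} P? Q? P⊆Q zero q ¬p Q⊆P with P? zero | Q? zero
  ... | yes p | _     = ⊥-elim (¬p p)
  ... | no _  | no ¬q = ⊥-elim (¬q q)
  ... | no _  | yes _ = cong suc (count-cong (λ x → Q? (suc x)) (λ x → P? (suc x))
                          (λ x → Q⊆P (suc x) (λ ())) (λ x → P⊆Q (suc x)))
  count-one-more {suc n} P? Q? P⊆Q (suc x₀) q ¬p Q⊆P with P? zero | Q? zero
  ... | yes _  | yes _ = cong suc (count-one-more (λ x → P? (suc x)) (λ x → Q? (suc x)) (λ x → P⊆Q (suc x))
                           x₀ q ¬p (λ x x≢x₀ → Q⊆P (suc x) (λ e → x≢x₀ (suc-injective e))))
  ... | yes p  | no ¬q = ⊥-elim (¬q (P⊆Q zero p))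
  ... | no ¬p₀ | yes q₀ = ⊥-elim (¬p₀ (Q⊆P zero (λ ()) q₀))
  ... | no _   | no _  = count-one-more (λ x → P? (suc x)) (λ x → Q? (suc x)) (λ x → P⊆Q (suc x))
                           x₀ q ¬p (λ x x≢x₀ → Q⊆P (suc x) (λ e → x≢x₀ (suc-injective e)))

  count-all : {P : Fin n → Set} (P? : ∀ x → Dec (P x)) → (∀ x → P x) → count P P? ≡ n
  count-all {zero}  P? all = refl
  count-all {suc n} P? all with P? zero
  ... | yes _ = cong suc (count-all (λ x → P? (suc x)) (λ x → all (suc x)))
  ... | no ¬p = ⊥-elim (¬p (all zero))

  count-none : {P : Fin n → Set} (P? : ∀ x → Dec (P x)) → (∀ x → ¬ P x) → count P P? ≡ 0
  count-none {zero}  P? none = refl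
  count-none {suc n} P? none with P? zero
  ... | yes p = ⊥-elim (none zero p)
  ... | no _  = count-none (λ x → P? (suc x)) (λ x → none (suc x))

  count-only-zero : {P : Fin (suc n) → Set} (P? : ∀ x → Dec (P x))
    → P zero → (∀ x → ¬ P (suc x)) → count P P? ≡ 1
  count-only-zero P? p₀ none with P? zero
  ... | yes _  = cong suc (count-none (λ x → P? (suc x)) none)
  ... | no ¬p₀ = ⊥-elim (¬p₀ p₀)

-- x is the least element (by index) of its R-class.  Each class has exactly
-- one leader, so the number of classes is the number of leaders.
Leader : (Fin n → Fin n → Set) → Fin n → Set
Leader R x = ∀ y → toℕ y < toℕ x → ¬ R y x

leader-dec : {R : Fin n → Fin n → Set} → (∀ x y → Dec (R x y)) → ∀ x → Dec (Leader R x)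
leader-dec R? x = all? (λ y → (toℕ y ℕ.<? toℕ x) →-dec ¬? (R? y x))

classes : (R : Fin n → Fin n → Set) → (∀ x y → Dec (R x y)) → ℕ
classes R R? = count (Leader R) (leader-dec R?)

classes-cong : {R R′ : Fin n → Fin n → Set} (R? : ∀ x y → Dec (R x y)) (R′? : ∀ x y → Dec (R′ x y))
  → (∀ x y → R x y → R′ x y) → (∀ x y → R′ x y → R x y) → classes R R? ≡ classes R′ R′?
classes-cong R? R′? R⊆R′ R′⊆R = count-cong (leader-dec R?) (leader-dec R′?)
  (λ x lead y y<x r′ → lead y y<x (R′⊆R y x r′))
  (λ x lead y y<x r → lead y y<x (R⊆R′ y x r))

classes-total : {R : Fin (suc n) → Fin (suc n) → Set} (R? : ∀ x y → Dec (R x y))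
  → (∀ x y → R x y) → classes R R? ≡ 1
classes-total R? total =
  count-only-zero (leader-dec R?) (λ _ ()) (λ x lead → lead zero (s≤s z≤n) (total zero (suc x)))

classes-discrete : {R : Fin n → Fin n → Set} (R? : ∀ x y → Dec (R x y))
  → (∀ x y → R x y → x ≡ y) → classes R R? ≡ n
classes-discrete R? discrete =
  count-all (leader-dec R?) (λ x y y<x r → ℕ.<-irrefl (cong toℕ (discrete y x r)) y<x)

least : (P : Fin n → Set) → (∀ x → Dec (P x)) → ∀ x → P x
  → Σ (Fin n) λ x₀ → P x₀ × (∀ y → toℕ y < toℕ x₀ → ¬ P y)
least P P? zero p = zero , p , λ _ ()
least {suc n} P P? (suc x) p with P? zero
... | yes p₀ = zero , p₀ , λ _ ()
... | no ¬p₀ with least (λ z → P (suc z)) (λ z → P? (suc z)) x p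
...   | x₀ , px₀ , below = suc x₀ , px₀ , λ { zero _ → ¬p₀ ; (suc y) (s≤s y<x₀) → below y y<x₀ }

module _ {R : Fin n → Fin n → Set} (E : IsEquivalence R) (R? : ∀ x y → Dec (R x y)) where
  open IsEquivalence E renaming (refl to ≈-refl; sym to ≈-sym; trans to _⨾_)

  leader-unique : ∀ {x x′} → Leader R x → Leader R x′ → R x x′ → x ≡ x′
  leader-unique {x} {x′} lead lead′ r with ℕ.<-cmp (toℕ x) (toℕ x′)
  ... | tri< x<x′ _ _ = ⊥-elim (lead′ x x<x′ r)
  ... | tri≈ _ x≡x′ _ = toℕ-injective x≡x′
  ... | tri> _ _ x′<x = ⊥-elim (lead x′ x′<x (≈-sym r))

  ClassLeader : Fin n → Set
  ClassLeader a = Σ (Fin n) λ x → R x a × Leader R x × (∀ y → R y a → toℕ x ≤ toℕ y)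

  classLeader : ∀ a → ClassLeader a
  classLeader a with least (λ y → R y a) (λ y → R? y a) a ≈-refl
  ... | x , xa , below = x , xa , (λ y y<x yx → below y y<x (yx ⨾ xa)) , (λ y ya → ℕ.≮⇒≥ (λ y<x → below y y<x ya))

  -- If R′ is R with the distinct classes of a and b joined, R has exactly one
  -- more class: the leaders of R′ are those of R except the larger of the two
  -- leaders of the joined classes.
  module _ {R′ : Fin n → Fin n → Set} (R′? : ∀ x y → Dec (R′ x y)) where

    private
      join-ordered : ∀ a b → (∀ x y → R′ x y → Join R a b x y) → (∀ x y → Join R a b x y → R′ x y)
        → (A : ClassLeader a) (B : ClassLeader b) → toℕ (proj₁ A) < toℕ (proj₁ B)
        → classes R R? ≡ suc (classes R′ R′?)
      join-ordered a b to from (xa , xa~a , lead-a , min-a) (xb , xb~b , lead-b , min-b) xa<xb =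
        count-one-more (leader-dec R′?) (leader-dec R?)
          (λ x lead′ y y<x r → lead′ y y<x (from y x (inj₁ r)))
          xb lead-b (λ lead′ → lead′ xa xa<xb (from xa xb (inj₂ (inj₁ (xa~a , ≈-sym xb~b)))))
          others
        where
        others : ∀ x → x ≢ xb → Leader R x → Leader R′ x
        others x x≢xb lead y y<x r′ with to y x r′
        ... | inj₁ r = lead y y<x r
        ... | inj₂ (inj₁ (_ , bx)) = x≢xb (leader-unique lead lead-b (≈-sym bx ⨾ ≈-sym xb~b))
        ... | inj₂ (inj₂ (yb , ax)) with leader-unique lead lead-a (≈-sym ax ⨾ ≈-sym xa~a)
        ...   | refl = ℕ.<-irrefl refl (ℕ.<-≤-trans (ℕ.<-trans y<x xa<xb) (min-b y yb))

    classes-join : ∀ a b → ¬ R a b → (∀ x y → R′ x y → Join R a b x y) → (∀ x y → Join R a b x y → R′ x y)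
      → classes R R? ≡ suc (classes R′ R′?)
    classes-join a b ¬ab to from with classLeader a | classLeader b
    ... | A | B with ℕ.<-cmp (toℕ (proj₁ A)) (toℕ (proj₁ B))
    ...   | tri< A<B _ _ = join-ordered a b to from A B A<B
    ...   | tri> _ _ B<A = join-ordered b a (λ x y r′ → join-swap {R = R} (to x y r′))
                                             (λ x y j → from x y (join-swap {R = R} j)) B A B<A
    ...   | tri≈ _ A≡B _ = ⊥-elim (¬ab (≈-sym (proj₁ (proj₂ A))
                              ⨾ subst (λ z → R z b) (sym (toℕ-injective A≡B)) (proj₁ (proj₂ B))))

module Merge {f : Fin n → Fin n} (f-inj : Inj f) (a b : Fin n) (¬ab : ¬ SameCycle f a b) where

  g : Fin n → Fin n
  g x = τ a b (f x)

  g-inj : Inj g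
  g-inj = ∘-inj (τ-inj a b) f-inj

  -- The union of the two cycles being merged; g and f agree outside it.
  InAB : Fin n → Set
  InAB z = SameCycle f a z ⊎ SameCycle f b z

  private
    back : ∀ {c z} → SameCycle f c (f z) → SameCycle f c z
    back c~fz = sameCycle-trans c~fz (sameCycle-sym f-inj sameCycle-step)

    inAB-f : ∀ {z} → InAB z → InAB (f z)
    inAB-f (inj₁ a~z) = inj₁ (sameCycle-trans a~z sameCycle-step)
    inAB-f (inj₂ b~z) = inj₂ (sameCycle-trans b~z sameCycle-step)

    inAB-g : ∀ {z} → InAB z → InAB (g z)
    inAB-g {z} z∈ with τ-cases a b (f z)
    ... | inj₁ gz≡fz        = subst InAB (sym gz≡fz) (inAB-f z∈)
    ... | inj₂ (inj₁ gz≡a) = subst InAB (sym gz≡a) (inj₁ sameCycle-refl)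
    ... | inj₂ (inj₂ gz≡b) = subst InAB (sym gz≡b) (inj₂ sameCycle-refl)

    outAB-f : ∀ {z} → ¬ InAB z → ¬ InAB (f z)
    outAB-f z∉ (inj₁ a~fz) = z∉ (inj₁ (back a~fz))
    outAB-f z∉ (inj₂ b~fz) = z∉ (inj₂ (back b~fz))

    outAB-g : ∀ {z} → ¬ InAB z → g z ≡ f z
    outAB-g z∉ = τ-other (λ fz≡a → outAB-f z∉ (subst InAB (sym fz≡a) (inj₁ sameCycle-refl)))
                         (λ fz≡b → outAB-f z∉ (subst InAB (sym fz≡b) (inj₂ sameCycle-refl)))

    outAB-iter : ∀ {x} → ¬ InAB x → ∀ k → (iter g k x ≡ iter f k x) × ¬ InAB (iter f k x)
    outAB-iter x∉ zero = refl , x∉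
    outAB-iter x∉ (suc k) with outAB-iter x∉ k
    ... | gᵏx≡fᵏx , fᵏx∉ = ≡-trans (cong g gᵏx≡fᵏx) (outAB-g fᵏx∉) , outAB-f fᵏx∉

    inAB-iter : ∀ {x} → InAB x → ∀ k → InAB (iter g k x)
    inAB-iter x∈ zero    = x∈
    inAB-iter x∈ (suc k) = inAB-g (inAB-iter x∈ k)

    inAB-join : ∀ {x y} → InAB x → InAB y → Join (SameCycle f) a b x y
    inAB-join (inj₁ a~x) (inj₁ a~y) = inj₁ (sameCycle-trans (sameCycle-sym f-inj a~x) a~y)
    inAB-join (inj₁ a~x) (inj₂ b~y) = inj₂ (inj₁ (sameCycle-sym f-inj a~x , b~y))
    inAB-join (inj₂ b~x) (inj₁ a~y) = inj₂ (inj₂ (sameCycle-sym f-inj b~x , a~y))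
    inAB-join (inj₂ b~x) (inj₂ b~y) = inj₁ (sameCycle-trans (sameCycle-sym f-inj b~x) b~y)

    -- Following the f-cycle of c, g agrees with f until f returns to c, since
    -- the other point d is not on that cycle; so g's cycle of c contains it.
    follow : (c d : Fin n) → (∀ z → f z ≢ c → f z ≢ d → g z ≡ f z) → ¬ SameCycle f c d
      → ∀ k → SameCycle g c (iter f k c)
    follow c d g≡f ¬cd zero = sameCycle-refl
    follow c d g≡f ¬cd (suc k) with f (iter f k c) ≟ c
    ... | yes fᵏ⁺¹c≡c = subst (SameCycle g c) (sym fᵏ⁺¹c≡c) sameCycle-refl
    ... | no fᵏ⁺¹c≢c  = sameCycle-trans (follow c d g≡f ¬cd k)
                          (1 , g≡f _ fᵏ⁺¹c≢c (λ fᵏ⁺¹c≡d → ¬cd (suc k , fᵏ⁺¹c≡d)))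

    cycle-a : ∀ {x} → SameCycle f a x → SameCycle g a x
    cycle-a (k , fᵏa≡x) = subst (SameCycle g a) fᵏa≡x (follow a b (λ _ → τ-other) ¬ab k)

    cycle-b : ∀ {x} → SameCycle f b x → SameCycle g b x
    cycle-b (k , fᵏb≡x) = subst (SameCycle g b) fᵏb≡x
      (follow b a (λ _ ≢b ≢a → τ-other ≢a ≢b) (λ b~a → ¬ab (sameCycle-sym f-inj b~a)) k)

    -- Just before returning to a, the f-cycle of a reaches f⁻¹ a, which g sends to b.
    a~b : SameCycle g a b
    a~b with periodic f-inj a
    ... | p , fᵖ⁺¹a≡a = sameCycle-trans (follow a b (λ _ → τ-other) ¬ab p)
                          (1 , ≡-trans (cong (τ a b) fᵖ⁺¹a≡a) (τ-left a b))

  to : ∀ x y → SameCycle g x y → Join (SameCycle f) a b x y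
  to x y (k , gᵏx≡y) with sameCycle-dec f-inj a x ⊎-dec sameCycle-dec f-inj b x
  ... | no x∉  = inj₁ (k , ≡-trans (sym (proj₁ (outAB-iter x∉ k))) gᵏx≡y)
  ... | yes x∈ = inAB-join x∈ (subst InAB gᵏx≡y (inAB-iter x∈ k))

  from : ∀ x y → Join (SameCycle f) a b x y → SameCycle g x y
  from x y (inj₁ (k , fᵏx≡y)) with sameCycle-dec f-inj a x ⊎-dec sameCycle-dec f-inj b x
  ... | no x∉ = k , ≡-trans (proj₁ (outAB-iter x∉ k)) fᵏx≡y
  ... | yes (inj₁ a~x) =
    sameCycle-trans (sameCycle-sym g-inj (cycle-a a~x)) (cycle-a (sameCycle-trans a~x (k , fᵏx≡y)))
  ... | yes (inj₂ b~x) =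
    sameCycle-trans (sameCycle-sym g-inj (cycle-b b~x)) (cycle-b (sameCycle-trans b~x (k , fᵏx≡y)))
  from x y (inj₂ (inj₁ (x~a , b~y))) =
    sameCycle-trans (sameCycle-sym g-inj (cycle-a (sameCycle-sym f-inj x~a)))
      (sameCycle-trans a~b (cycle-b b~y))
  from x y (inj₂ (inj₂ (x~b , a~y))) =
    sameCycle-trans (sameCycle-sym g-inj (cycle-b (sameCycle-sym f-inj x~b)))
      (sameCycle-trans (sameCycle-sym g-inj a~b) (cycle-a a~y))

least-ℕ : (P : ℕ → Set) → (∀ k → Dec (P k)) → ∀ m → P m → Σ ℕ λ k → P k × (∀ j → j < k → ¬ P j)
least-ℕ P P? zero p = 0 , p , λ _ ()
least-ℕ P P? (suc m) p with P? 0
... | yes p₀ = 0 , p₀ , λ _ ()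
... | no ¬p₀ with least-ℕ (λ k → P (suc k)) (λ k → P? (suc k)) m p
...   | k , pk , below = suc k , pk , λ { zero _ → ¬p₀ ; (suc j) (s≤s j<k) → below j j<k }

module Split {f : Fin n → Fin n} (f-inj : Inj f) (a b : Fin n) (a≢b : a ≢ b) (a~b : SameCycle f a b) where

  g : Fin n → Fin n
  g x = τ a b (f x)

  g-inj : Inj g
  g-inj = ∘-inj (τ-inj a b) f-inj

  -- With m minimal such that fᵐ a = b, g maps the arc a, f a, …, fᵐ⁻¹ a into
  -- itself (its last point goes to τ b = a), and b is not on that arc.
  private
    arc-avoids-b : ∀ m → iter f m a ≡ b → (∀ j → j < m → iter f j a ≢ b) → ¬ SameCycle g a b
    arc-avoids-b zero    fᵐa≡b _ = ⊥-elim (a≢b fᵐa≡b)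
    arc-avoids-b (suc m) fᵐa≡b below (k , gᵏa≡b) = b∉arc (subst OnArc gᵏa≡b (g-orbit k))
      where
      OnArc : Fin n → Set
      OnArc z = ∃ λ j → j ≤ m × iter f j a ≡ z

      g-arc : ∀ {z} → OnArc z → OnArc (g z)
      g-arc (j , j≤m , refl) with ℕ.m≤n⇒m<n∨m≡n j≤m
      ... | inj₂ refl = 0 , z≤n , sym (≡-trans (cong (τ a b) fᵐa≡b) (τ-right a b))
      ... | inj₁ j<m  = suc j , j<m , sym (τ-other fʲ⁺¹a≢a fʲ⁺¹a≢b)
        where
        fʲ⁺¹a≢b : f (iter f j a) ≢ b
        fʲ⁺¹a≢b = below (suc j) (s≤s j<m)
        m-j+j+1≡m+1 : (m ∸ j) + suc j ≡ suc m
        m-j+j+1≡m+1 = ≡-trans (ℕ.+-suc (m ∸ j) j) (cong suc (ℕ.m∸n+n≡m (ℕ.<⇒≤ j<m)))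
        -- otherwise b = fᵐ⁻ʲ a would be reached before step m + 1
        fʲ⁺¹a≢a : f (iter f j a) ≢ a
        fʲ⁺¹a≢a fʲ⁺¹a≡a = below (m ∸ j) (s≤s (ℕ.m∸n≤m m j)) (begin
          iter f (m ∸ j) a                    ≡⟨ cong (iter f (m ∸ j)) (sym fʲ⁺¹a≡a) ⟩
          iter f (m ∸ j) (iter f (suc j) a)   ≡⟨ sym (iter-+ f (m ∸ j) (suc j) a) ⟩
          iter f ((m ∸ j) + suc j) a          ≡⟨ cong (λ k → iter f k a) m-j+j+1≡m+1 ⟩
          iter f (suc m) a                    ≡⟨ fᵐa≡b ⟩
          b                                   ∎)
          where open ≡-Reasoning

      g-orbit : ∀ k → OnArc (iter g k a)
      g-orbit zero    = 0 , z≤n , refl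
      g-orbit (suc k) = g-arc (g-orbit k)

      b∉arc : ¬ OnArc b
      b∉arc (j , j≤m , fʲa≡b) = below j (s≤s j≤m) fʲa≡b

  ¬g-ab : ¬ SameCycle g a b
  ¬g-ab with least-ℕ (λ k → iter f k a ≡ b) (λ k → iter f k a ≟ b) (proj₁ a~b) (proj₂ a~b)
  ... | m , fᵐa≡b , below = arc-avoids-b m fᵐa≡b below

  -- f = (a b)g, so this is merging for g.
  private
    module M = Merge g-inj a b ¬g-ab

    τg≗f : ∀ z → M.g z ≡ f z
    τg≗f z = τ-involutive a b (f z)

  to : ∀ x y → SameCycle f x y → Join (SameCycle g) a b x y
  to x y x~y = M.to x y (sameCycle-cong (λ z → sym (τg≗f z)) x~y)

  from : ∀ x y → Join (SameCycle g) a b x y → SameCycle f x y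
  from x y j = sameCycle-cong τg≗f (M.from x y j)

-- The number l(f) of cycles of an injective map f, kept opaque: only the
-- facts below are used, and unfolding the count is expensive.
opaque
  cycles : (f : Fin n → Fin n) → Inj f → ℕ
  cycles f f-inj = classes (SameCycle f) (sameCycle-dec f-inj)

  cycles-cong : {f g : Fin n → Fin n} (f-inj : Inj f) (g-inj : Inj g)
    → (∀ x → f x ≡ g x) → cycles f f-inj ≡ cycles g g-inj
  cycles-cong f-inj g-inj f≗g = classes-cong (sameCycle-dec f-inj) (sameCycle-dec g-inj)
    (λ _ _ → sameCycle-cong f≗g) (λ _ _ → sameCycle-cong (λ z → sym (f≗g z)))

  cycles-merge : {f : Fin n → Fin n} (f-inj : Inj f) (a b : Fin n) (g-inj : Inj (λ x → τ a b (f x)))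
    → ¬ SameCycle f a b → cycles f f-inj ≡ suc (cycles (λ x → τ a b (f x)) g-inj)
  cycles-merge f-inj a b g-inj ¬ab =
    classes-join (sameCycle-isEquivalence f-inj) (sameCycle-dec f-inj) (sameCycle-dec g-inj) a b ¬ab
      (Merge.to f-inj a b ¬ab) (Merge.from f-inj a b ¬ab)

  cycles-split : {f : Fin n → Fin n} (f-inj : Inj f) (a b : Fin n) (g-inj : Inj (λ x → τ a b (f x)))
    → a ≢ b → SameCycle f a b → cycles (λ x → τ a b (f x)) g-inj ≡ suc (cycles f f-inj)
  cycles-split f-inj a b g-inj a≢b a~b =
    classes-join (sameCycle-isEquivalence g-inj) (sameCycle-dec g-inj) (sameCycle-dec f-inj) a b
      (Split.¬g-ab f-inj a b a≢b a~b) (Split.to f-inj a b a≢b a~b) (Split.from f-inj a b a≢b a~b)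

  cycles-identity : {f : Fin n → Fin n} (f-inj : Inj f) → (∀ x → f x ≡ x) → cycles f f-inj ≡ n
  cycles-identity {f = f} f-inj fixed =
    classes-discrete (sameCycle-dec f-inj) (λ x y (k , fᵏx≡y) → ≡-trans (sym (fixed-iter k x)) fᵏx≡y)
    where
    fixed-iter : ∀ k x → iter f k x ≡ x
    fixed-iter zero    x = refl
    fixed-iter (suc k) x = ≡-trans (cong f (fixed-iter k x)) (fixed x)

  cycles-single : {f : Fin (suc n) → Fin (suc n)} (f-inj : Inj f)
    → (∀ x y → SameCycle f x y) → cycles f f-inj ≡ 1
  cycles-single {f = f} f-inj single = classes-total {R = SameCycle f} (sameCycle-dec f-inj) single

-- Orbits of ⟨ts⟩: reflexive-transitive closure of the generator steps, which is
-- symmetric because every generator is an involution.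
⟦⟧-inj : (t : Transposition n) → Inj ⟦ t ⟧
⟦⟧-inj (trans a b _) = τ-inj a b

module _ {ts : List (Transposition n)} where

  orbit-trans : ∀ {x y z} → Orbit ts x y → Orbit ts y z → Orbit ts x z
  orbit-trans here         yz = yz
  orbit-trans (step t∈ xy) yz = step t∈ (orbit-trans xy yz)

  orbit-step : ∀ {t x} → t ∈ ts → Orbit ts x (⟦ t ⟧ x)
  orbit-step t∈ = step t∈ here

  orbit-sym : ∀ {x y} → Orbit ts x y → Orbit ts y x
  orbit-sym here = here
  orbit-sym {x} (step {t = trans a b _} t∈ xy) =
    orbit-trans (orbit-sym xy) (step t∈ (subst (λ z → Orbit ts z x) (sym (τ-involutive a b x)) here))

orbit-isEquivalence : (ts : List (Transposition n)) → IsEquivalence (Orbit ts)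
orbit-isEquivalence ts = record { refl = here ; sym = orbit-sym ; trans = orbit-trans }

orbit-weaken : ∀ {ts : List (Transposition n)} {t x y} → Orbit ts x y → Orbit (t ∷ ts) x y
orbit-weaken here         = here
orbit-weaken (step t∈ xy) = step (there t∈) (orbit-weaken xy)

module OrbitCons (a b : Fin n) (a≢b : a ≢ b) (ts : List (Transposition n)) where

  private
    J = Join (Orbit ts) a b
    module JE = IsEquivalence (join-isEquivalence (orbit-isEquivalence ts) a b)

    ab-step : ∀ x → J x (τ a b x)
    ab-step x = by-cases (x ≟ a) (x ≟ b)
      where
      by-cases : Dec (x ≡ a) → Dec (x ≡ b) → J x (τ a b x)
      by-cases (yes refl) _          = subst (J a) (sym (τ-left a b)) (inj₂ (inj₁ (here , here)))
      by-cases (no _)     (yes refl) = subst (J b) (sym (τ-right a b)) (inj₂ (inj₂ (here , here)))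
      by-cases (no x≢a)   (no x≢b)   = subst (J x) (sym (τ-other x≢a x≢b)) (inj₁ here)

    a~b : Orbit (trans a b a≢b ∷ ts) a b
    a~b = step (here refl) (subst (λ z → Orbit (trans a b a≢b ∷ ts) z b) (sym (τ-left a b)) here)

  to : ∀ {x y} → Orbit (trans a b a≢b ∷ ts) x y → J x y
  to here                       = inj₁ here
  to {x} (step (here refl) xy)  = JE.trans (ab-step x) (to xy)
  to (step (there t∈) xy)       = JE.trans (inj₁ (orbit-step t∈)) (to xy)

  from : ∀ {x y} → J x y → Orbit (trans a b a≢b ∷ ts) x y
  from (inj₁ xy)               = orbit-weaken xy
  from (inj₂ (inj₁ (xa , by))) = orbit-trans (orbit-weaken xa) (orbit-trans a~b (orbit-weaken by))
  from (inj₂ (inj₂ (xb , ay))) = orbit-trans (orbit-weaken xb) (orbit-trans (orbit-sym a~b) (orbit-weaken ay))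

orbit-dec : (ts : List (Transposition n)) → ∀ x y → Dec (Orbit ts x y)
orbit-dec [] x y with x ≟ y
... | yes refl = yes here
... | no x≢y   = no λ { here → x≢y refl ; (step () _) }
orbit-dec (trans a b a≢b ∷ ts) x y =
  map′ (OrbitCons.from a b a≢b ts) (OrbitCons.to a b a≢b ts) (join-dec (orbit-dec ts) a b x y)

prod-inj : (ts : List (Transposition n)) → Inj (prod ts)
prod-inj []       e = e
prod-inj (t ∷ ts) e = prod-inj ts (⟦⟧-inj t e)

sameCycle⇒orbit : (ts : List (Transposition n)) → ∀ {x y} → SameCycle (prod ts) x y → Orbit ts x y
sameCycle⇒orbit ts {x} (k , refl) = iterates k
  where
  prod-orbit : ∀ (us : List (Transposition n)) z → Orbit us z (prod us z)
  prod-orbit []       z = here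
  prod-orbit (u ∷ us) z = orbit-trans (orbit-weaken (prod-orbit us z)) (orbit-step (here refl))
  iterates : ∀ k → Orbit ts x (iter (prod ts) k x)
  iterates zero    = here
  iterates (suc k) = orbit-trans (iterates k) (prod-orbit ts _)

opaque
  orbits : List (Transposition n) → ℕ
  orbits ts = classes (Orbit ts) (orbit-dec ts)

  orbits-nil : orbits ([] {A = Transposition n}) ≡ n
  orbits-nil = classes-discrete (orbit-dec []) λ { x .x here → refl ; x y (step () _) }

  orbits-within : ∀ {a b} (a≢b : a ≢ b) (ts : List (Transposition n))
    → Orbit ts a b → orbits (trans a b a≢b ∷ ts) ≡ orbits ts
  orbits-within {a = a} {b} a≢b ts a~b = classes-cong (orbit-dec (trans a b a≢b ∷ ts)) (orbit-dec ts)
    (λ x y xy → join-collapse (orbit-isEquivalence ts) a~b (OrbitCons.to a b a≢b ts xy))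
    (λ x y xy → OrbitCons.from a b a≢b ts (inj₁ xy))

  orbits-across : ∀ {a b} (a≢b : a ≢ b) (ts : List (Transposition n))
    → ¬ Orbit ts a b → orbits ts ≡ suc (orbits (trans a b a≢b ∷ ts))
  orbits-across {a = a} {b} a≢b ts ¬ab =
    classes-join (orbit-isEquivalence ts) (orbit-dec ts) (orbit-dec (trans a b a≢b ∷ ts)) a b ¬ab
      (λ x y → OrbitCons.to a b a≢b ts) (λ x y → OrbitCons.from a b a≢b ts)

  orbits-transitive : (ts : List (Transposition (suc n))) → TransitiveOn ts → orbits ts ≡ 1
  orbits-transitive ts transitive = classes-total {R = Orbit ts} (orbit-dec ts) transitive

cycles-τ-≤ : {f : Fin n → Fin n} (f-inj : Inj f) (a b : Fin n) (g-inj : Inj (λ x → τ a b (f x)))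
  → a ≢ b → cycles (λ x → τ a b (f x)) g-inj ≤ suc (cycles f f-inj)
cycles-τ-≤ {f = f} f-inj a b g-inj a≢b with sameCycle-dec f-inj a b
... | yes a~b = ℕ.≤-reflexive (cycles-split f-inj a b g-inj a≢b a~b)
... | no ¬ab  = begin
  cycles (λ x → τ a b (f x)) g-inj        ≤⟨ ℕ.n≤1+n _ ⟩
  suc (cycles (λ x → τ a b (f x)) g-inj)  ≡⟨ sym (cycles-merge f-inj a b g-inj ¬ab) ⟩
  cycles f f-inj                          ≤⟨ ℕ.n≤1+n _ ⟩
  suc (cycles f f-inj)                    ∎
  where open ℕ.≤-Reasoning

-- By induction on ts.  A transposition (a b) inside one orbit keeps c and adds
-- at most one cycle; between two orbits it lowers c by one and, since cycles
-- lie inside orbits, merges two cycles.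
lower-bound : (ts : List (Transposition n))
  → n + cycles (prod ts) (prod-inj ts) ≤ length ts + (orbits ts + orbits ts)
lower-bound {n} [] = ℕ.≤-reflexive (begin
  n + cycles (prod {n} []) (prod-inj [])  ≡⟨ cong (n +_) (cycles-identity (prod-inj {n} []) (λ _ → refl)) ⟩
  n + n                                  ≡⟨ cong (λ c → c + c) (sym orbits-nil) ⟩
  orbits {n} [] + orbits []              ∎)
  where open ≡-Reasoning
lower-bound {n} (trans a b a≢b ∷ ts) with orbit-dec ts a b
... | yes a~b = begin
  n + cycles π′ (prod-inj (t ∷ ts))   ≤⟨ ℕ.+-monoʳ-≤ n (cycles-τ-≤ (prod-inj ts) a b (prod-inj (t ∷ ts)) a≢b) ⟩
  n + suc (cycles π (prod-inj ts))    ≡⟨ ℕ.+-suc n _ ⟩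
  suc (n + cycles π (prod-inj ts))    ≤⟨ s≤s (lower-bound ts) ⟩
  suc (length ts + (orbits ts + orbits ts))
                                      ≡⟨ cong (λ c → suc (length ts + (c + c))) (sym (orbits-within a≢b ts a~b)) ⟩
  suc (length ts) + (orbits (t ∷ ts) + orbits (t ∷ ts)) ∎
  where
  open ℕ.≤-Reasoning
  t : Transposition n
  t = trans a b a≢b
  π π′ : Fin n → Fin n
  π = prod ts
  π′ = prod (t ∷ ts)
... | no ¬ab = ℕ.≤-pred (begin
  suc (n + l′)                  ≡⟨ sym (ℕ.+-suc n l′) ⟩
  n + suc l′                    ≡⟨ cong (n +_) (sym fewer-cycles) ⟩
  n + cycles π (prod-inj ts)    ≤⟨ lower-bound ts ⟩
  length ts + (orbits ts + orbits ts)
                                ≡⟨ cong (λ c → length ts + (c + c)) (orbits-across a≢b ts ¬ab) ⟩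
  length ts + (suc c′ + suc c′) ≡⟨ cong (length ts +_) (cong suc (ℕ.+-suc c′ c′)) ⟩
  length ts + suc (suc (c′ + c′)) ≡⟨ ℕ.+-suc (length ts) (suc (c′ + c′)) ⟩
  suc (length ts + suc (c′ + c′)) ≡⟨ cong suc (ℕ.+-suc (length ts) (c′ + c′)) ⟩
  suc (suc (length ts + (c′ + c′))) ∎)
  where
  open ℕ.≤-Reasoning
  t : Transposition n
  t = trans a b a≢b
  π : Fin n → Fin n
  π = prod ts
  l′ c′ : ℕ
  l′ = cycles (prod (t ∷ ts)) (prod-inj (t ∷ ts))
  c′ = orbits (t ∷ ts)
  fewer-cycles : cycles π (prod-inj ts) ≡ suc l′
  fewer-cycles = cycles-merge (prod-inj ts) a b (prod-inj (t ∷ ts)) (λ a~b → ¬ab (sameCycle⇒orbit ts a~b))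

-- The points moved by f; their number is the induction measure for factorize.
Moved : (Fin n → Fin n) → Fin n → Set
Moved f x = f x ≢ x

moved? : (f : Fin n → Fin n) → ∀ x → Dec (Moved f x)
moved? f x = ¬? (f x ≟ x)

Factorization : (f : Fin n → Fin n) → Inj f → Set
Factorization {n} f f-inj =
  Σ (List (Transposition n)) λ ts → (∀ x → f x ≡ prod ts x) × (length ts + cycles f f-inj ≡ n)

module SplitOff {f : Fin n → Fin n} (f-inj : Inj f) (x : Fin n) (moved : Moved f x) where

  x≢fx : x ≢ f x
  x≢fx x≡fx = moved (sym x≡fx)

  g : Fin n → Fin n
  g y = τ x (f x) (f y)

  g-inj : Inj g
  g-inj = ∘-inj (τ-inj x (f x)) f-inj

  fewer-moved : suc (count (Moved g) (moved? g)) ≤ count (Moved f) (moved? f)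
  fewer-moved = count-strict (moved? g) (moved? f) g-moved⇒f-moved x moved
    (λ g-moves-x → g-moves-x (τ-right x (f x)))
    where
    g-moved⇒f-moved : ∀ y → Moved g y → Moved f y
    g-moved⇒f-moved y g-moves-y fy≡y = g-moves-y (≡-trans (cong (τ x (f x)) fy≡y)
      (τ-other (λ y≡x → moved (subst (λ z → f z ≡ z) y≡x fy≡y))
               (λ y≡fx → moved (subst (λ z → f z ≡ z) (f-inj (≡-trans fy≡y y≡fx)) fy≡y))))

  more-cycles : cycles g g-inj ≡ suc (cycles f f-inj)
  more-cycles = cycles-split f-inj x (f x) g-inj x≢fx sameCycle-step

  undo : ∀ y → f y ≡ τ x (f x) (g y)
  undo y = sym (τ-involutive x (f x) (f y))

identity-factorization : {f : Fin n → Fin n} (f-inj : Inj f) → (∀ x → f x ≡ x) → Factorization f f-inj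
identity-factorization f-inj fixed = [] , fixed , cycles-identity f-inj fixed

factorize : ∀ k (f : Fin n → Fin n) (f-inj : Inj f) → count (Moved f) (moved? f) ≤ k → Factorization f f-inj
factorize {n} k f f-inj bound with all? (λ x → f x ≟ x)
... | yes fixed = identity-factorization f-inj fixed
... | no ¬fixed with ¬∀⟶∃¬ n _ (λ x → f x ≟ x) ¬fixed | k
...   | x , moved | zero  = ⊥-elim (ℕ.n≮0 (ℕ.≤-trans (SplitOff.fewer-moved f-inj x moved) bound))
...   | x , moved | suc k′ = trans x (f x) x≢fx ∷ ts , f≗ , length-ok
  where
  open SplitOff f-inj x moved
  rest : Factorization g g-inj
  rest = factorize k′ g g-inj (ℕ.≤-pred (ℕ.≤-trans fewer-moved bound))
  ts : List (Transposition n)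
  ts = proj₁ rest
  f≗ : ∀ y → f y ≡ τ x (f x) (prod ts y)
  f≗ y = ≡-trans (undo y) (cong (τ x (f x)) (proj₁ (proj₂ rest) y))
  length-ok : suc (length ts) + cycles f f-inj ≡ n
  length-ok = begin
    suc (length ts) + cycles f f-inj   ≡⟨ sym (ℕ.+-suc (length ts) _) ⟩
    length ts + suc (cycles f f-inj)   ≡⟨ cong (length ts +_) (sym more-cycles) ⟩
    length ts + cycles g g-inj         ≡⟨ proj₂ (proj₂ rest) ⟩
    n                                  ∎
    where open ≡-Reasoning

TransitiveFactorization : (f : Fin (suc n) → Fin (suc n)) → Inj f → Set
TransitiveFactorization {n} f f-inj = Σ (List (Transposition (suc n))) λ ts →
  (∀ x → f x ≡ prod ts x) × TransitiveOn ts × (length ts + 2 ≡ suc n + cycles f f-inj)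

-- A single cycle: any factorization is transitive, since cycles lie in orbits.
one-cycle-factorization : {f : Fin (suc n) → Fin (suc n)} (f-inj : Inj f)
  → (∀ y → SameCycle f zero y) → TransitiveFactorization f f-inj
one-cycle-factorization {n} {f} f-inj zero~ = ts , f≗ , transitive , length-ok
  where
  open IsEquivalence (sameCycle-isEquivalence f-inj) renaming (sym to ≈-sym; trans to _⨾_)
  one-cycle : cycles f f-inj ≡ 1
  one-cycle = cycles-single f-inj (λ x y → ≈-sym (zero~ x) ⨾ zero~ y)
  F : Factorization f f-inj
  F = factorize _ f f-inj ℕ.≤-refl
  ts : List (Transposition (suc n))
  ts = proj₁ F
  f≗ : ∀ x → f x ≡ prod ts x
  f≗ = proj₁ (proj₂ F)
  transitive : TransitiveOn ts
  transitive x y = sameCycle⇒orbit ts (sameCycle-cong f≗ (≈-sym (zero~ x) ⨾ zero~ y))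
  length-ok : length ts + 2 ≡ suc n + cycles f f-inj
  length-ok = begin
    length ts + 2                     ≡⟨ ℕ.+-suc (length ts) 1 ⟩
    suc (length ts + 1)               ≡⟨ cong (λ l → suc (length ts + l)) (sym one-cycle) ⟩
    suc (length ts + cycles f f-inj)  ≡⟨ cong suc (proj₂ (proj₂ F)) ⟩
    suc (suc n)                       ≡⟨ ℕ.+-comm 1 (suc n) ⟩
    suc n + 1                         ≡⟨ cong (suc n +_) (sym one-cycle) ⟩
    suc n + cycles f f-inj            ∎
    where open ≡-Reasoning

-- By induction on a bound k for l(f): while some b lies off the cycle of 0,
-- merge it in with (0 b) and recurse on (0 b)f.
transitive-factorize : ∀ k (f : Fin (suc n) → Fin (suc n)) (f-inj : Inj f)
  → cycles f f-inj ≤ k → TransitiveFactorization f f-inj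
transitive-factorize {n} k f f-inj bound with all? (sameCycle-dec f-inj zero)
... | yes zero~ = one-cycle-factorization f-inj zero~
... | no ¬zero~ with ¬∀⟶∃¬ (suc n) _ (sameCycle-dec f-inj zero) ¬zero~ | k
...   | b , ¬0~b | zero   = ⊥-elim (ℕ.n≮0 (subst (_≤ 0) fewer-cycles bound))
  where
  fewer-cycles : cycles f f-inj ≡ suc (cycles (λ y → τ zero b (f y)) (∘-inj (τ-inj zero b) f-inj))
  fewer-cycles = cycles-merge f-inj zero b _ ¬0~b
...   | b , ¬0~b | suc k′ = trans zero b 0≢b ∷ ts , f≗ , transitive , length-ok
  where
  0≢b : zero ≢ b
  0≢b 0≡b = ¬0~b (0 , 0≡b)
  g : Fin (suc n) → Fin (suc n)
  g y = τ zero b (f y)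
  g-inj : Inj g
  g-inj = ∘-inj (τ-inj zero b) f-inj
  fewer-cycles : cycles f f-inj ≡ suc (cycles g g-inj)
  fewer-cycles = cycles-merge f-inj zero b g-inj ¬0~b
  rest : TransitiveFactorization g g-inj
  rest = transitive-factorize k′ g g-inj (ℕ.≤-pred (subst (_≤ suc k′) fewer-cycles bound))
  ts : List (Transposition (suc n))
  ts = proj₁ rest
  f≗ : ∀ y → f y ≡ τ zero b (prod ts y)
  f≗ y = ≡-trans (sym (τ-involutive zero b (f y))) (cong (τ zero b) (proj₁ (proj₂ rest) y))
  transitive : TransitiveOn (trans zero b 0≢b ∷ ts)
  transitive x y = orbit-weaken (proj₁ (proj₂ (proj₂ rest)) x y)
  length-ok : suc (length ts) + 2 ≡ suc n + cycles f f-inj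
  length-ok = begin
    suc (length ts + 2)          ≡⟨ cong suc (proj₂ (proj₂ (proj₂ rest))) ⟩
    suc (suc n + cycles g g-inj) ≡⟨ sym (ℕ.+-suc (suc n) _) ⟩
    suc n + suc (cycles g g-inj) ≡⟨ cong (suc n +_) (sym fewer-cycles) ⟩
    suc n + cycles f f-inj       ∎
    where open ≡-Reasoning

-- A map g that agrees with f on an f-invariant decidable set S and is the
-- identity elsewhere: a cycle ρ of σ (S a σ-cycle), or a product ρ₁ρ₂ of two
-- disjoint cycles (S the union of two σ-cycles).
module Restriction {f : Fin n → Fin n} (f-inj : Inj f) (S : Fin n → Set) (S? : ∀ x → Dec (S x))
  (S-closed : ∀ {z} → S z → S (f z))
  {g : Fin n → Fin n} (agrees : ∀ x → (S x → g x ≡ f x) × (¬ S x → g x ≡ x)) where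

  private
    on : ∀ {x} → S x → g x ≡ f x
    on = proj₁ (agrees _)

    off : ∀ {x} → ¬ S x → g x ≡ x
    off = proj₂ (agrees _)

  g-inj : Inj g
  g-inj {x} {y} gx≡gy with S? x | S? y
  ... | yes x∈ | yes y∈ = f-inj (≡-trans (sym (on x∈)) (≡-trans gx≡gy (on y∈)))
  ... | yes x∈ | no y∉  = ⊥-elim (y∉ (subst S (≡-trans (sym (on x∈)) (≡-trans gx≡gy (off y∉))) (S-closed x∈)))
  ... | no x∉  | yes y∈ = ⊥-elim (x∉ (subst S (≡-trans (sym (on y∈)) (≡-trans (sym gx≡gy) (off x∉))) (S-closed y∈)))
  ... | no x∉  | no y∉  = ≡-trans (sym (off x∉)) (≡-trans gx≡gy (off y∉))

  private
    iter-inside : ∀ {x} → S x → ∀ k → (iter g k x ≡ iter f k x) × S (iter f k x)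
    iter-inside x∈ zero = refl , x∈
    iter-inside x∈ (suc k) with iter-inside x∈ k
    ... | gᵏx≡fᵏx , fᵏx∈ = ≡-trans (cong g gᵏx≡fᵏx) (on fᵏx∈) , S-closed fᵏx∈

  sameCycle-inside : ∀ {x y} → S x → SameCycle f x y → SameCycle g x y
  sameCycle-inside x∈ (k , fᵏx≡y) = k , ≡-trans (proj₁ (iter-inside x∈ k)) fᵏx≡y

  sameCycle-inside⁻ : ∀ {x y} → S x → SameCycle g x y → SameCycle f x y
  sameCycle-inside⁻ x∈ (k , gᵏx≡y) = k , ≡-trans (sym (proj₁ (iter-inside x∈ k))) gᵏx≡y

permutation-inj : (σ : Permutation′ n) → Inj (σ ⟨$⟩ʳ_)
permutation-inj σ {x} {y} σx≡σy = ≡-trans (sym (inverseˡ σ)) (≡-trans (cong (σ ⟨$⟩ˡ_) σx≡σy) (inverseˡ σ))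

split-cycle : (σ : Permutation′ n) (j₁ j₂ : Fin n) → j₂ ≢ j₁ → SameCycle (σ ⟨$⟩ʳ_) j₁ j₂
  → (ρ₁ : Fin n → Fin n) → IsCycleOf σ j₁ ρ₁
  → ¬ SameCycle (λ x → τ j₂ j₁ (ρ₁ x)) j₁ j₂
    × (∀ x → τ j₂ j₁ (ρ₁ x) ≡ x ⊎ SameCycle (λ y → τ j₂ j₁ (ρ₁ y)) j₁ x
                               ⊎ SameCycle (λ y → τ j₂ j₁ (ρ₁ y)) j₂ x)
split-cycle {n} σ j₁ j₂ j₂≢j₁ j₁~j₂ ρ₁ ρ₁-cycle = (λ j₁~j₂′ → SP.¬g-ab (sameCycle-sym SP.g-inj j₁~j₂′)) , each
  where
  σ-inj : Inj (σ ⟨$⟩ʳ_)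
  σ-inj = permutation-inj σ
  C : Fin n → Set
  C = SameCycle (σ ⟨$⟩ʳ_) j₁
  module R = Restriction σ-inj C (sameCycle-dec σ-inj j₁)
    (λ j₁~z → sameCycle-trans j₁~z sameCycle-step) ρ₁-cycle
  module SP = Split R.g-inj j₂ j₁ j₂≢j₁ (sameCycle-sym R.g-inj (R.sameCycle-inside sameCycle-refl j₁~j₂))
  each : ∀ x → SP.g x ≡ x ⊎ SameCycle SP.g j₁ x ⊎ SameCycle SP.g j₂ x
  each x with sameCycle-dec σ-inj j₁ x
  ... | yes j₁~x with SP.to j₁ x (R.sameCycle-inside sameCycle-refl j₁~x)
  ...   | inj₁ j₁~x′                  = inj₂ (inj₁ j₁~x′)
  ...   | inj₂ (inj₁ (_ , j₁~x′))     = inj₂ (inj₁ j₁~x′)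
  ...   | inj₂ (inj₂ (_ , j₂~x))      = inj₂ (inj₂ j₂~x)
  each x | no ¬j₁~x = inj₁ (≡-trans (cong (τ j₂ j₁) (proj₂ (ρ₁-cycle x) ¬j₁~x))
    (τ-other (λ x≡j₂ → ¬j₁~x (subst C (sym x≡j₂) j₁~j₂))
             (λ x≡j₁ → ¬j₁~x (subst C (sym x≡j₁) sameCycle-refl))))

merge-cycles : (σ : Permutation′ n) (j₁ j₂ : Fin n) → ¬ SameCycle (σ ⟨$⟩ʳ_) j₁ j₂
  → (ρ₁ ρ₂ : Fin n → Fin n) → IsCycleOf σ j₁ ρ₁ → IsCycleOf σ j₂ ρ₂
  → SameCycle (λ y → τ j₂ j₁ (ρ₁ (ρ₂ y))) j₁ j₂
    × (∀ x → τ j₂ j₁ (ρ₁ (ρ₂ x)) ≡ x ⊎ SameCycle (λ y → τ j₂ j₁ (ρ₁ (ρ₂ y))) j₁ x)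
merge-cycles {n} σ j₁ j₂ ¬j₁~j₂ ρ₁ ρ₂ ρ₁-cycle ρ₂-cycle =
  MG.from j₁ j₂ (inj₂ (inj₂ (sameCycle-refl , sameCycle-refl))) , each
  where
  f : Fin n → Fin n
  f = σ ⟨$⟩ʳ_
  σ-inj : Inj f
  σ-inj = permutation-inj σ
  C₁ C₂ S : Fin n → Set
  C₁ = SameCycle f j₁
  C₂ = SameCycle f j₂
  S x = C₁ x ⊎ C₂ x
  S? : ∀ x → Dec (S x)
  S? x = sameCycle-dec σ-inj j₁ x ⊎-dec sameCycle-dec σ-inj j₂ x
  disjoint : ∀ {x} → C₁ x → ¬ C₂ x
  disjoint j₁~x j₂~x = ¬j₁~j₂ (sameCycle-trans j₁~x (sameCycle-sym σ-inj j₂~x))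
  S-closed : ∀ {z} → S z → S (f z)
  S-closed (inj₁ j₁~z) = inj₁ (sameCycle-trans j₁~z sameCycle-step)
  S-closed (inj₂ j₂~z) = inj₂ (sameCycle-trans j₂~z sameCycle-step)
  agrees : ∀ x → (S x → ρ₁ (ρ₂ x) ≡ f x) × (¬ S x → ρ₁ (ρ₂ x) ≡ x)
  agrees x = on , off
    where
    on : S x → ρ₁ (ρ₂ x) ≡ f x
    on (inj₁ j₁~x) = ≡-trans (cong ρ₁ (proj₂ (ρ₂-cycle x) (disjoint j₁~x))) (proj₁ (ρ₁-cycle x) j₁~x)
    on (inj₂ j₂~x) = ≡-trans (cong ρ₁ (proj₁ (ρ₂-cycle x) j₂~x))
      (proj₂ (ρ₁-cycle (f x)) (λ j₁~fx → disjoint j₁~fx (sameCycle-trans j₂~x sameCycle-step)))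
    off : ¬ S x → ρ₁ (ρ₂ x) ≡ x
    off x∉ = ≡-trans (cong ρ₁ (proj₂ (ρ₂-cycle x) (λ j₂~x → x∉ (inj₂ j₂~x))))
                     (proj₂ (ρ₁-cycle x) (λ j₁~x → x∉ (inj₁ j₁~x)))
  module R = Restriction σ-inj S S? S-closed agrees
  module MG = Merge R.g-inj j₂ j₁
    (λ j₂~j₁ → ¬j₁~j₂ (sameCycle-sym σ-inj (R.sameCycle-inside⁻ (inj₂ sameCycle-refl) j₂~j₁)))
  each : ∀ x → MG.g x ≡ x ⊎ SameCycle MG.g j₁ x
  each x with S? x
  ... | yes (inj₁ j₁~x) = inj₂ (MG.from j₁ x (inj₁ (R.sameCycle-inside (inj₁ sameCycle-refl) j₁~x)))
  ... | yes (inj₂ j₂~x) =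
    inj₂ (MG.from j₁ x (inj₂ (inj₂ (sameCycle-refl , R.sameCycle-inside (inj₂ sameCycle-refl) j₂~x))))
  ... | no x∉ = inj₁ (≡-trans (cong (τ j₂ j₁) (proj₂ (agrees x) x∉))
    (τ-other (λ x≡j₂ → x∉ (inj₂ (subst C₂ (sym x≡j₂) sameCycle-refl)))
             (λ x≡j₁ → x∉ (inj₁ (subst C₁ (sym x≡j₁) sameCycle-refl)))))

remaining-product : {σ : Permutation′ n} {a b : Fin n} (a≢b : a ≢ b) {rest : List (Transposition n)}
  → (∀ x → σ ⟨$⟩ʳ x ≡ prod (trans a b a≢b ∷ rest) x) → ∀ x → τ a b (σ ⟨$⟩ʳ x) ≡ prod rest x
remaining-product {a = a} {b} a≢b {rest} σ≗ x =
  ≡-trans (cong (τ a b) (σ≗ x)) (τ-involutive a b (prod rest x))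

transitive-without : {a b : Fin n} (a≢b : a ≢ b) (rest : List (Transposition n))
  → TransitiveOn (trans a b a≢b ∷ rest) → Orbit rest a b → TransitiveOn rest
transitive-without a≢b rest transitive a~b x y =
  join-collapse (orbit-isEquivalence rest) a~b (OrbitCons.to _ _ a≢b rest (transitive x y))

transitive-lower-bound : (ts : List (Transposition (suc n))) → TransitiveOn ts
  → suc n + cycles (prod ts) (prod-inj ts) ≤ length ts + 2
transitive-lower-bound {n} ts transitive =
  subst (λ c → suc n + cycles (prod ts) (prod-inj ts) ≤ length ts + (c + c))
        (orbits-transitive ts transitive) (lower-bound ts)

minimal-length : (σ : Permutation′ (suc n)) {ts : List (Transposition (suc n))} → MinTransFact σ ts
  → length ts + 2 ≤ suc n + cycles (σ ⟨$⟩ʳ_) (permutation-inj σ)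
minimal-length {n} σ {ts} (_ , minimal)
  with transitive-factorize _ (σ ⟨$⟩ʳ_) (permutation-inj σ) ℕ.≤-refl
... | ts* , σ≗ , transitive , length-ok = begin
  length ts + 2                                 ≤⟨ ℕ.+-monoˡ-≤ 2 (minimal ts* (σ≗ , transitive)) ⟩
  length ts* + 2                                ≡⟨ length-ok ⟩
  suc n + cycles (σ ⟨$⟩ʳ_) (permutation-inj σ)  ∎
  where open ℕ.≤-Reasoning

-- Case (1): if τ₂, …, τ_μ were still transitive, τ₂⋯τ_μ = τ₁σ, which has one
-- cycle more than σ, would need n + l(σ) − 1 factors — more than the μ − 1
-- it has.  So j₁ and j₂ lie in different orbits, and these cover everything.
orbits-split : (σ : Permutation′ (suc n)) (j₁ j₂ : Fin (suc n)) (j₂≢j₁ : j₂ ≢ j₁)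
  (rest : List (Transposition (suc n))) → MinTransFact σ (trans j₂ j₁ j₂≢j₁ ∷ rest)
  → SameCycle (σ ⟨$⟩ʳ_) j₁ j₂ → ¬ Orbit rest j₁ j₂ × (∀ x → Orbit rest j₁ x ⊎ Orbit rest j₂ x)
orbits-split {n} σ j₁ j₂ j₂≢j₁ rest minimal@((σ≗ , transitive) , _) j₁~j₂ = ¬j₁~j₂ , two-orbits
  where
  σ-inj : Inj (σ ⟨$⟩ʳ_)
  σ-inj = permutation-inj σ
  l : ℕ
  l = cycles (σ ⟨$⟩ʳ_) σ-inj
  more-cycles : cycles (prod rest) (prod-inj rest) ≡ suc l
  more-cycles = ≡-trans
    (sym (cycles-cong (∘-inj (τ-inj j₂ j₁) σ-inj) (prod-inj rest) (remaining-product {σ = σ} j₂≢j₁ {rest} σ≗)))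
    (cycles-split σ-inj j₂ j₁ _ j₂≢j₁ (sameCycle-sym σ-inj j₁~j₂))
  ¬j₁~j₂ : ¬ Orbit rest j₁ j₂
  ¬j₁~j₂ j₁~j₂′ = ℕ.<-irrefl refl (begin-strict
    length rest + 2                      <⟨ ℕ.n<1+n _ ⟩
    suc (length rest) + 2                ≤⟨ minimal-length σ minimal ⟩
    suc n + l                            <⟨ ℕ.+-monoʳ-< (suc n) (ℕ.n<1+n l) ⟩
    suc n + suc l                        ≡⟨ cong (suc n +_) (sym more-cycles) ⟩
    suc n + cycles (prod rest) (prod-inj rest)
      ≤⟨ transitive-lower-bound rest (transitive-without j₂≢j₁ rest transitive (orbit-sym j₁~j₂′)) ⟩
    length rest + 2                      ∎)
    where open ℕ.≤-Reasoning
  two-orbits : ∀ x → Orbit rest j₁ x ⊎ Orbit rest j₂ x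
  two-orbits x with OrbitCons.to j₂ j₁ j₂≢j₁ rest (transitive j₁ x)
  ... | inj₁ j₁~x              = inj₁ j₁~x
  ... | inj₂ (inj₁ (_ , j₁~x)) = inj₁ j₁~x
  ... | inj₂ (inj₂ (_ , j₂~x)) = inj₂ j₂~x

-- Case (2): τ₁σ merges the cycles of j₁ and j₂, so they share an orbit of
-- ⟨τ₂, …⟩ and removing τ₁ keeps transitivity.
orbits-merge : (σ : Permutation′ n) (j₁ j₂ : Fin n) (j₂≢j₁ : j₂ ≢ j₁) (rest : List (Transposition n))
  → TransFact σ (trans j₂ j₁ j₂≢j₁ ∷ rest) → ¬ SameCycle (σ ⟨$⟩ʳ_) j₁ j₂ → TransitiveOn rest
orbits-merge σ j₁ j₂ j₂≢j₁ rest (σ≗ , transitive) ¬j₁~j₂ =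
  transitive-without j₂≢j₁ rest transitive
    (sameCycle⇒orbit rest (sameCycle-cong (remaining-product {σ = σ} j₂≢j₁ {rest} σ≗) j₂~j₁))
  where
  σ-inj : Inj (σ ⟨$⟩ʳ_)
  σ-inj = permutation-inj σ
  j₂~j₁ : SameCycle (λ x → τ j₂ j₁ (σ ⟨$⟩ʳ x)) j₂ j₁
  j₂~j₁ = Merge.from σ-inj j₂ j₁ (λ j₂~j₁ → ¬j₁~j₂ (sameCycle-sym σ-inj j₂~j₁)) j₂ j₁
            (inj₂ (inj₁ (sameCycle-refl , sameCycle-refl)))

lemma2p3 : (n : ℕ) → 1 ≤ n → (σ : Permutation′ n)
    → (j₁ j₂ : Fin n) (d : j₂ ≢ j₁) (rest : List (Transposition n))
    → MinTransFact σ (trans j₂ j₁ d ∷ rest)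
    → ((SameCycle (σ ⟨$⟩ʳ_) j₁ j₂
          → (ρ₁ : Fin n → Fin n) → IsCycleOf σ j₁ ρ₁
          → (¬ SameCycle (λ x → transpose j₂ j₁ ⟨$⟩ʳ ρ₁ x) j₁ j₂
              × (∀ x → (transpose j₂ j₁ ⟨$⟩ʳ ρ₁ x ≡ x)
                       ⊎ SameCycle (λ y → transpose j₂ j₁ ⟨$⟩ʳ ρ₁ y) j₁ x
                       ⊎ SameCycle (λ y → transpose j₂ j₁ ⟨$⟩ʳ ρ₁ y) j₂ x))
            × (¬ Orbit rest j₁ j₂ × (∀ x → Orbit rest j₁ x ⊎ Orbit rest j₂ x)))
      × (¬ SameCycle (σ ⟨$⟩ʳ_) j₁ j₂
          → (ρ₁ ρ₂ : Fin n → Fin n) → IsCycleOf σ j₁ ρ₁ → IsCycleOf σ j₂ ρ₂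
          → (SameCycle (λ y → transpose j₂ j₁ ⟨$⟩ʳ ρ₁ (ρ₂ y)) j₁ j₂
              × (∀ x → (transpose j₂ j₁ ⟨$⟩ʳ ρ₁ (ρ₂ x) ≡ x)
                       ⊎ SameCycle (λ y → transpose j₂ j₁ ⟨$⟩ʳ ρ₁ (ρ₂ y)) j₁ x))
            × TransitiveOn rest))
lemma2p3 zero () σ j₁ j₂ d rest minimal
lemma2p3 (suc m) _ σ j₁ j₂ d rest minimal@(factorization , _) =
  (λ j₁~j₂ ρ₁ ρ₁-cycle →
      split-cycle σ j₁ j₂ d j₁~j₂ ρ₁ ρ₁-cycle , orbits-split σ j₁ j₂ d rest minimal j₁~j₂)
  , (λ ¬j₁~j₂ ρ₁ ρ₂ ρ₁-cycle ρ₂-cycle →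
      merge-cycles σ j₁ j₂ ¬j₁~j₂ ρ₁ ρ₂ ρ₁-cycle ρ₂-cycle , orbits-merge σ j₁ j₂ d rest factorization ¬j₁~j₂)
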